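{- Let $G$ be a finite simple connected graph and let $v \in V(G)$ be a vertex that is not a cut vertex of $G$. Then $$\chi_{dd}(G)-1 \leq \chi_{dd}(G-v) \leq \chi_{dd}(G)+\deg(v)-1.$$
   Context: All graphs are finite, simple, undirected and connected. For a vertex $v$, $N(v)$ is its open neighborhood, $N[v]=N(v)\cup\{v\}$ its closed neighborhood, and $\deg(v)=|N(v)|$. A proper coloring of $G$ partitions $V(G)$ into independent sets $V_1,\dots,V_k$ (color classes). A vertex $u$ dominates a color class $V_i$ if $V_i \subseteq N[u]$ (so $u$ dominates its own class only when that class is $\{u\}$). A domination coloring of $G$ is a proper vertex coloring such that every vertex of $G$ dominates at least one color class, and every color class is dominated by at least one vertex. The domination chromatic number $\chi_{dd}(G)$ is the minimum number of color classes in a domination coloring of $G$. $G-v$ is the graph obtained by deleting $v$ and all edges incident with $v$. -}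

module Defs where

open import Data.Nat using (ℕ; suc)
open import Data.Fin using (Fin; punchIn)
open import Data.List using (List; length; filter)
open import Data.List using () renaming (allFin to allFinL)
open import Data.Product using (Σ; ∃; _×_; _,_)
open import Data.Sum using (_⊎_)
open import Relation.Nullary using (¬_; Dec)
open import Relation.Binary.PropositionalEquality using (_≡_)

record Graph (n : ℕ) : Set₁ where
  field
    Adj   : Fin n → Fin n → Set
    adj?  : ∀ u w → Dec (Adj u w)
    sym   : ∀ {u w} → Adj u w → Adj w u
    irrefl : ∀ {u} → ¬ Adj u u
open Graph public

data Walk {n : ℕ} (G : Graph n) : Fin n → Fin n → Set where
  here : ∀ {u} → Walk G u u
  step : ∀ {u w x} → Adj G u w → Walk G w x → Walk G u x

Connected : ∀ {n} → Graph n → Set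
Connected {n} G = ∀ (u w : Fin n) → Walk G u w

delete : ∀ {n} → Graph (suc n) → Fin (suc n) → Graph n
delete G v = record
  { Adj = λ a b → Adj G (punchIn v a) (punchIn v b)
  ; adj? = λ a b → adj? G (punchIn v a) (punchIn v b)
  ; sym = sym G
  ; irrefl = irrefl G
  }

CutVertex : ∀ {n} → Graph (suc n) → Fin (suc n) → Set
CutVertex G v = ¬ Connected (delete G v)

deg : ∀ {n} → Graph n → Fin n → ℕ
deg {n} G v = length (filter (adj? G v) (allFinL n))

InClosedNbhd : ∀ {n} → Graph n → Fin n → Fin n → Set
InClosedNbhd G u w = (w ≡ u) ⊎ Adj G u w

Surjective : ∀ {n k} → (Fin n → Fin k) → Set
Surjective {n} {k} c = ∀ (i : Fin k) → ∃ λ (w : Fin n) → c w ≡ i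

Proper : ∀ {n k} → Graph n → (Fin n → Fin k) → Set
Proper G c = ∀ u w → Adj G u w → ¬ (c u ≡ c w)

Dominates : ∀ {n k} → Graph n → (Fin n → Fin k) → Fin n → Fin k → Set
Dominates {n} G c u i = ∀ (w : Fin n) → c w ≡ i → InClosedNbhd G u w

record DomColoring {n : ℕ} (G : Graph n) (k : ℕ) : Set where
  field
    color      : Fin n → Fin k
    surjective : Surjective color
    proper     : Proper G color
    vertexDom  : ∀ (u : Fin n) → ∃ λ (i : Fin k) → Dominates G color u i
    classDom   : ∀ (i : Fin k) → ∃ λ (u : Fin n) → Dominates G color u i

IsChiDD : ∀ {n} → Graph n → ℕ → Set
IsChiDD {n} G k = DomColoring G k × (∀ m → DomColoring G m → k Data.Nat.≤ m)

-- Both bounds come from transporting a domination colouring from one graph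
-- to the other.  To avoid bookkeeping about empty colour classes we work with
-- colourings into an arbitrary type in which only the colours actually used
-- count as classes (IsDomColoring).  Such a colouring into Fin K can always be
-- compressed to a genuine domination colouring with at most K classes, so it
-- bounds χdd by K (chiDD-≤).
--
--  * Lower bound: colour v with a fresh colour and G - v as before; v then
--    dominates its singleton class, so χdd(G) ≤ χdd(G - v) + 1.
--  * Upper bound: take a colouring of G with k+1 classes and a class C that
--    v dominates.  In G - v give each neighbour of v its own new colour; the
--    remaining vertices keep their colours, and none of them lies in C, so
--    they use only k colours.  Hence χdd(G - v) ≤ k + deg(v).
--
-- Neither bound needs connectivity or that v is not a cut vertex.
module Submission where

open import Defs
open import Data.Nat using (ℕ; zero; suc; _+_; _∸_; _≤_)
open import Data.Nat.Base using (s≤s⁻¹)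
open import Data.Nat.Properties using (≤-refl; ≤-trans; m≤n⇒m≤1+n)
open import Data.Fin using (Fin; punchIn; punchOut; join; splitAt)
open import Data.Fin.Properties
  using (¬Fin0; 0≢1+n; suc-injective; punchIn-injective; punchInᵢ≢i;
         punchIn-punchOut; punchOut-injective; splitAt-join; any?; all?; ¬∀⟶∃¬)
  renaming (_≟_ to _≟ᶠ_)
open import Data.Product using (_×_; _,_; ∃; proj₁; proj₂)
open import Data.Sum using (_⊎_; inj₁; inj₂)
open import Data.Sum.Properties using (inj₁-injective; inj₂-injective)
open import Data.Empty using (⊥-elim)
open import Relation.Nullary using (¬_; Dec; yes; no)
open import Relation.Binary.PropositionalEquality
  using (_≡_; _≢_; refl; trans; cong; subst) renaming (sym to ≡-sym)
open import Data.List using (filter; lookup) renaming (allFin to allFinL)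
open import Data.List.Relation.Unary.Any using (index)
open import Data.List.Relation.Unary.Any.Properties using (lookup-index)
open import Data.List.Membership.Propositional.Properties using (∈-filter⁺; ∈-allFin)

DominatesColour : ∀ {n} {A : Set} → Graph n → (Fin n → A) → Fin n → A → Set
DominatesColour {n} G c u a = ∀ (x : Fin n) → c x ≡ a → InClosedNbhd G u x

-- A domination colouring whose classes are the nonempty fibres of c; colours
-- are referred to through a vertex carrying them, so unused colours are ignored.
record IsDomColoring {n} (G : Graph n) {A : Set} (c : Fin n → A) : Set where
  field
    proper    : ∀ u w → Adj G u w → c u ≢ c w
    vertexDom : ∀ u → ∃ λ w → DominatesColour G c u (c w)
    classDom  : ∀ w → ∃ λ u → DominatesColour G c u (c w)
open IsDomColoring

fromDomColoring : ∀ {n k} {G : Graph n} (D : DomColoring G k) →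
  IsDomColoring G (DomColoring.color D)
fromDomColoring {G = G} D = record
  { proper    = D.proper
  ; vertexDom = λ u → let (i , d) = D.vertexDom u ; (w , e) = D.surjective i in
                      w , subst (DominatesColour G D.color u) (≡-sym e) d
  ; classDom  = λ w → D.classDom (D.color w) }
  where module D = DomColoring D

-- Passing to a finer colouring c' (c' x ≡ c' y implies c x ≡ c y) preserves
-- the domination property: classes only shrink.
refine : ∀ {n} {G : Graph n} {A B : Set} {c : Fin n → A} (c' : Fin n → B) →
  (∀ x y → c' x ≡ c' y → c x ≡ c y) → IsDomColoring G c → IsDomColoring G c'
refine {G = G} {c = c} c' finer dc = record
  { proper    = λ u w a e → proper dc u w a (finer u w e)
  ; vertexDom = λ u → let (w , d) = vertexDom dc u in w , shrink d
  ; classDom  = λ w → let (u , d) = classDom dc w in u , shrink d }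
  where
  shrink : ∀ {u w} → DominatesColour G c u (c w) → DominatesColour G c' u (c' w)
  shrink {w = w} d x e = d x (finer x w e)

-- Removing unused colours one at a time turns a colouring into Fin K into a
-- genuine domination colouring with at most K classes.
compress : ∀ {n} {G : Graph n} (K : ℕ) (c : Fin n → Fin K) → IsDomColoring G c →
  ∃ λ m → m ≤ K × DomColoring G m
compress {G = G} K c dc with all? (λ i → any? (λ w → c w ≟ᶠ i))
... | yes onto = K , ≤-refl , record
  { color      = c
  ; surjective = onto
  ; proper     = proper dc
  ; vertexDom  = λ u → let (w , d) = vertexDom dc u in c w , d
  ; classDom   = λ i → let (w , e) = onto i ; (u , d) = classDom dc w in
                       u , subst (Dominates G c u) e d }
compress zero c dc | no notOnto = ⊥-elim (notOnto λ ())
compress {n} (suc K) c dc | no notOnto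
  with ¬∀⟶∃¬ (suc K) _ (λ i → any? (λ w → c w ≟ᶠ i)) notOnto
... | unused , isUnused =
  let (m , m≤K , D) = compress K c' (refine c' finer dc) in m , m≤n⇒m≤1+n m≤K , D
  where
  avoids : ∀ w → unused ≢ c w
  avoids w e = isUnused (w , ≡-sym e)
  c' : Fin n → Fin K
  c' w = punchOut (avoids w)
  finer : ∀ x y → c' x ≡ c' y → c x ≡ c y
  finer x y = punchOut-injective (avoids x) (avoids y)

chiDD-≤ : ∀ {n k K} {G : Graph n} {c : Fin n → Fin K} →
  IsChiDD G k → IsDomColoring G c → k ≤ K
chiDD-≤ {K = K} {c = c} (_ , minimal) dc =
  let (m , m≤K , D) = compress K c dc in ≤-trans (minimal m D) m≤K

data VertexView {n} (v : Fin (suc n)) : Fin (suc n) → Set where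
  isV   : VertexView v v
  other : ∀ y → VertexView v (punchIn v y)

view : ∀ {n} (v a : Fin (suc n)) → VertexView v a
view v a with v ≟ᶠ a
... | yes refl = isV
... | no v≢a   = subst (VertexView v) (punchIn-punchOut v≢a) (other (punchOut v≢a))

nbhd-delete : ∀ {n} (G : Graph (suc n)) v {y x : Fin n} →
  InClosedNbhd G (punchIn v y) (punchIn v x) → InClosedNbhd (delete G v) y x
nbhd-delete G v {y} {x} (inj₁ e) = inj₁ (punchIn-injective v x y e)
nbhd-delete G v (inj₂ a) = inj₂ a

nbhd-undelete : ∀ {n} (G : Graph (suc n)) v {y x : Fin n} →
  InClosedNbhd (delete G v) y x → InClosedNbhd G (punchIn v y) (punchIn v x)
nbhd-undelete G v (inj₁ e) = inj₁ (cong (punchIn v) e)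
nbhd-undelete G v (inj₂ a) = inj₂ a

nbhd-of-v : ∀ {n} (G : Graph (suc n)) v y →
  InClosedNbhd G v (punchIn v y) → Adj G v (punchIn v y)
nbhd-of-v G v y (inj₁ e) = ⊥-elim (punchInᵢ≢i v y e)
nbhd-of-v G v y (inj₂ a) = a

v-in-nbhd : ∀ {n} (G : Graph (suc n)) v y →
  InClosedNbhd G (punchIn v y) v → Adj G v (punchIn v y)
v-in-nbhd G v y (inj₁ e) = ⊥-elim (punchInᵢ≢i v y (≡-sym e))
v-in-nbhd G v y (inj₂ a) = Graph.sym G a

module FreshColour {n k} (G : Graph (suc n)) (v : Fin (suc n))
                   (c : Fin n → Fin k) (dc : IsDomColoring (delete G v) c) where

  c⁺ : Fin (suc n) → Fin (suc k)
  c⁺ a with v ≟ᶠ a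
  ... | yes _   = Fin.zero
  ... | no v≢a  = Fin.suc (c (punchOut v≢a))

  c⁺-v : c⁺ v ≡ Fin.zero
  c⁺-v with v ≟ᶠ v
  ... | yes _  = refl
  ... | no v≢v = ⊥-elim (v≢v refl)

  c⁺-other : ∀ y → c⁺ (punchIn v y) ≡ Fin.suc (c y)
  c⁺-other y with v ≟ᶠ punchIn v y
  ... | yes e  = ⊥-elim (punchInᵢ≢i v y (≡-sym e))
  ... | no v≢a = cong (λ z → Fin.suc (c z)) (punchIn-injective v _ _ (punchIn-punchOut v≢a))

  singleton : ∀ {y} → c⁺ v ≢ c⁺ (punchIn v y)
  singleton {y} e = 0≢1+n (trans (≡-sym c⁺-v) (trans e (c⁺-other y)))

  v-dominates : DominatesColour G c⁺ v (c⁺ v)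
  v-dominates x e with view v x
  ... | isV     = inj₁ refl
  ... | other y = ⊥-elim (singleton (≡-sym e))

  lift : ∀ {u w} → DominatesColour (delete G v) c u (c w) →
    DominatesColour G c⁺ (punchIn v u) (c⁺ (punchIn v w))
  lift {w = w} d x e with view v x
  ... | isV     = ⊥-elim (singleton e)
  ... | other y = nbhd-undelete G v (d y (suc-injective
                    (trans (≡-sym (c⁺-other y)) (trans e (c⁺-other w)))))

  isDomColoring : IsDomColoring G c⁺
  proper isDomColoring a b ab e with view v a | view v b
  ... | isV     | isV     = irrefl G ab
  ... | isV     | other z = singleton e
  ... | other y | isV     = singleton (≡-sym e)
  ... | other y | other z = proper dc y z ab (suc-injective
                              (trans (≡-sym (c⁺-other y)) (trans e (c⁺-other z))))
  vertexDom isDomColoring a with view v a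
  ... | isV     = v , v-dominates
  ... | other y = let (w , d) = vertexDom dc y in punchIn v w , lift d
  classDom isDomColoring a with view v a
  ... | isV     = v , v-dominates
  ... | other y = let (u , d) = classDom dc y in punchIn v u , lift d

neighbourIndex : ∀ {n} (G : Graph n) v {a} → Adj G v a → Fin (deg G v)
neighbourIndex {n} G v {a} p = index (∈-filter⁺ (adj? G v) (∈-allFin a) p)

neighbourIndex-injective : ∀ {n} (G : Graph n) v {a b} (p : Adj G v a) (q : Adj G v b) →
  neighbourIndex G v p ≡ neighbourIndex G v q → a ≡ b
neighbourIndex-injective {n} G v {a} {b} p q e =
  trans (lookup-index (∈-filter⁺ (adj? G v) (∈-allFin a) p))
    (trans (cong (lookup (filter (adj? G v) (allFinL n))) e)
           (≡-sym (lookup-index (∈-filter⁺ (adj? G v) (∈-allFin b) q))))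

-- Upper bound: recolour G - v, giving each neighbour of v a new colour of its
-- own and keeping the colours of the others, which avoid the class C = c w₀
-- dominated by v.
module NewNeighbourColours {n k} (G : Graph (suc n)) (v : Fin (suc n))
                           (c : Fin (suc n) → Fin (suc k)) (dc : IsDomColoring G c) where

  H : Graph n
  H = delete G v

  w₀ : Fin (suc n)
  w₀ = proj₁ (vertexDom dc v)

  outsideC : ∀ y → ¬ Adj G v (punchIn v y) → c w₀ ≢ c (punchIn v y)
  outsideC y np e = np (nbhd-of-v G v y (proj₂ (vertexDom dc v) (punchIn v y) (≡-sym e)))

  recolour : Fin n → Fin k ⊎ Fin (deg G v)
  recolour y with adj? G v (punchIn v y)
  ... | yes p  = inj₂ (neighbourIndex G v p)
  ... | no np  = inj₁ (punchOut (outsideC y np))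

  finer : ∀ x y → recolour x ≡ recolour y → c (punchIn v x) ≡ c (punchIn v y)
  finer x y e with adj? G v (punchIn v x) | adj? G v (punchIn v y)
  ... | yes p  | yes q  = cong c (neighbourIndex-injective G v p q (inj₂-injective e))
  ... | no np  | no nq  = punchOut-injective (outsideC x np) (outsideC y nq) (inj₁-injective e)
  finer x y () | yes p | no nq
  finer x y () | no np | yes q

  singleton : ∀ x y → Adj G v (punchIn v y) → recolour x ≡ recolour y → x ≡ y
  singleton x y q e with adj? G v (punchIn v x) | adj? G v (punchIn v y)
  ... | yes p  | yes q′ = punchIn-injective v x y (neighbourIndex-injective G v p q′ (inj₂-injective e))
  ... | _      | no nq  = ⊥-elim (nq q)
  singleton x y q () | no np | yes q′

  self-dominates : ∀ y → Adj G v (punchIn v y) → DominatesColour H recolour y (recolour y)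
  self-dominates y q x e = inj₁ (singleton x y q e)

  restrict : ∀ {u w} → DominatesColour G c (punchIn v u) (c (punchIn v w)) →
    DominatesColour H recolour u (recolour w)
  restrict {w = w} d x e = nbhd-delete G v (d (punchIn v x) (finer x w e))

  -- A neighbour of v dominates its own class; a non-neighbour dominates some
  -- class of G, which cannot be the class of v.
  vertexDomH : ∀ y → Dec (Adj G v (punchIn v y)) →
    ∃ λ w → DominatesColour H recolour y (recolour w)
  vertexDomH y (yes q) = y , self-dominates y q
  vertexDomH y (no np) with vertexDom dc (punchIn v y)
  ... | w , d with view v w
  ...   | isV      = ⊥-elim (np (v-in-nbhd G v y (d v refl)))
  ...   | other w′ = w′ , restrict d

  -- The class of a non-neighbour of v is dominated in G by a vertex other than v.
  classDomH : ∀ w → Dec (Adj G v (punchIn v w)) →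
    ∃ λ u → DominatesColour H recolour u (recolour w)
  classDomH w (yes q) = w , self-dominates w q
  classDomH w (no np) with classDom dc (punchIn v w)
  ... | u , d with view v u
  ...   | isV      = ⊥-elim (np (nbhd-of-v G v w (d (punchIn v w) refl)))
  ...   | other u′ = u′ , restrict d

  isDomColoring : IsDomColoring H (λ y → join k (deg G v) (recolour y))
  isDomColoring = refine _ joinFiner record
    { proper    = λ x y a e → proper dc (punchIn v x) (punchIn v y) a (finer x y e)
    ; vertexDom = λ y → vertexDomH y (adj? G v (punchIn v y))
    ; classDom  = λ w → classDomH w (adj? G v (punchIn v w)) }
    where
    joinFiner : ∀ x y → join k (deg G v) (recolour x) ≡ join k (deg G v) (recolour y) →
      recolour x ≡ recolour y
    joinFiner x y e = trans (≡-sym (splitAt-join k (deg G v) (recolour x)))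
      (trans (cong (splitAt k) e) (splitAt-join k (deg G v) (recolour y)))

-- χdd(G) ≥ 1 since G has a vertex; the two bounds are the two transports.
theorem1 : ∀ {n : ℕ} (G : Graph (suc n)) (v : Fin (suc n)) →
    Connected G → ¬ CutVertex G v →
    ∀ (k k' : ℕ) → IsChiDD G k → IsChiDD (delete G v) k' →
    (k ∸ 1 ≤ k') × (k' ≤ k + deg G v ∸ 1)
theorem1 G v _ _ zero k' (D , _) _ = ⊥-elim (¬Fin0 (DomColoring.color D v))
theorem1 G v _ _ (suc k) k' χG@(D , _) χH@(D' , _) =
  s≤s⁻¹ (chiDD-≤ χG (FreshColour.isDomColoring G v _ (fromDomColoring D'))) ,
  chiDD-≤ χH (NewNeighbourColours.isDomColoring G v _ (fromDomColoring D))
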